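{- Let $F\in\mathbb{Z}[X,Y]$ be a homogeneous polynomial of degree $n\in\mathbb{N}$, of content $1$ and without repeated factors. Then there exists $N_0\in\mathbb{N}$ such that for all integers $N$ divisible by $N_0$, the polynomial $\frac{F(X,NY)}{\mathrm{content}(F(X,NY))}\in\mathbb{Z}[X,Y]$ has no fixed prime divisor.
   Context: The content of an integer polynomial is the gcd of its coefficients. An integer $d>1$ is a fixed divisor of a polynomial $f(X_1,\dots,X_r)\in\mathbb{Z}[X_1,\dots,X_r]$ if $d$ divides $f(x_1,\dots,x_r)$ for all $x_1,\dots,x_r\in\mathbb{Z}$; a fixed prime divisor is a prime that is a fixed divisor. -}

module Defs where

open import Data.Nat using (ℕ; zero; suc)
open import Data.Integer using (ℤ; +_; -[1+_]; _+_; _*_; _^_; 0ℤ; 1ℤ; -1ℤ; _/_)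
open import Data.Integer.GCD using (gcd)
open import Data.Fin using (Fin; toℕ)
open import Data.Vec using (Vec; []; _∷_; foldr; lookup; tabulate; toList)
open import Data.List using (List; []; _∷_; map)

-- A binary form of degree n over ℤ is represented by its coefficient vector
-- (a₀, …, aₙ), standing for  F(X,Y) = Σᵢ aᵢ X^(n-i) Y^i.
Form : ℕ → Set
Form n = Vec ℤ (suc n)

eval : ∀ {n} → Form n → ℤ → ℤ → ℤ
eval {zero}  (a ∷ [])     x y = a
eval {suc n} (a ∷ as)     x y = a * x ^ suc n + y * eval as x y

content : ∀ {k} → Vec ℤ k → ℤ
content = foldr _ gcd 0ℤ

substNY : ∀ {n} → Form n → ℤ → Form n
substNY a N = tabulate (λ i → lookup a i * N ^ toℕ i)

-- division by a content (total: division by 0 returns 0; only used when exact)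
divBy : ℤ → ℤ → ℤ
divBy a (+ zero)    = 0ℤ
divBy a c@(+ suc k) = a / c
divBy a c@(-[1+ k ]) = a / c

primPart : ∀ {n} → Form n → Form n
primPart a = Data.Vec.map (λ c → divBy c (content a)) a

addL : List ℤ → List ℤ → List ℤ
addL []       ys       = ys
addL (x ∷ xs) []       = x ∷ xs
addL (x ∷ xs) (y ∷ ys) = (x + y) ∷ addL xs ys

mulL : List ℤ → List ℤ → List ℤ
mulL []       ys = []
mulL (x ∷ xs) ys = addL (map (x *_) ys) (0ℤ ∷ mulL xs ys)

-- F has no repeated factors: whenever F = G² · H in ℤ[X,Y]
-- (G, H forms, necessarily homogeneous as divisors of a form), G is a unit ±1.
NoRepeatedFactors : ∀ {n} → Form n → Set
NoRepeatedFactors {n} F =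
  ∀ (m k : ℕ) (G : Form m) (H : Form k) →
  toList F ≡ mulL (mulL (toList G) (toList G)) (toList H) →
  (toList G ≡ 1ℤ ∷ []) ⊎ (toList G ≡ -1ℤ ∷ [])
  where
    open import Relation.Binary.PropositionalEquality using (_≡_)
    open import Data.Sum using (_⊎_)

FixedPrimeDivisor : ∀ {n} → ℕ → Form n → Set
FixedPrimeDivisor p F = Prime p × (∀ (x y : ℤ) → (+ p) ∣ eval F x y)
  where
    open import Data.Nat.Primality using (Prime)
    open import Data.Product using (_×_)
    open import Data.Integer.Divisibility using (_∣_)

-- Let a be the first nonzero coefficient of F, that of X^(n-k) Y^k, and take N₀ = n! |a|.  A prime p > n is never a
-- fixed divisor of a primitive form of degree n: if p divides every value of a polynomial
-- in y of degree < p, it divides every coefficient (split off the values one at a time by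
-- synthetic division).  For p ≤ n we have a p ∣ N, so in F(X,NY) the coefficient u = a N^k
-- divides every coefficient and p u divides all later ones.  Hence u divides the content c,
-- and p c ∣ F(1,N) ≡ u (mod p u) would give p u ∣ u.
module Submission where

open import Defs
open import Data.Nat using (ℕ; _≤_)
open import Data.Integer using (ℤ; +_; 1ℤ)
open import Data.Integer.Divisibility using (_∣_)
open import Relation.Binary.PropositionalEquality using (_≡_; _≢_)
open import Relation.Nullary using (¬_)
open import Data.Product using (Σ; _×_)

open import Data.Nat as ℕ using (zero; suc; _!)
import Data.Nat.Properties as ℕP
import Data.Nat.Divisibility as ℕD
open import Data.Nat.Primality using (Prime; euclidsLemma; ¬prime[0]; ¬prime[1])
open import Data.Integer using (-[1+_]; _+_; _*_; _-_; _^_; _/_; _%_; 0ℤ; ∣_∣; NonZero; ≢-nonZero)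
open import Data.Integer.Properties
open import Data.Integer.DivMod using (a≡a%n+[a/n]*n; n%d<d)
open import Data.Integer.GCD using (gcd; gcd[i,j]∣i; gcd[i,j]∣j; gcd-greatest)
open import Data.Integer.Divisibility.Signed
  using (divides; ∣ᵤ⇒∣; ∣⇒∣ᵤ; ∣-refl; ∣-trans; ∣m∣n⇒∣m+n; ∣m∣n⇒∣m-n; ∣m+n∣m⇒∣n; ∣m+n∣n⇒∣m;
         ∣n⇒∣m*n; *-monoˡ-∣; *-monoʳ-∣; *-cancelʳ-∣; 0∣⇒≡0)
  renaming (_∣_ to _∣ₛ_)
open import Data.Integer.Tactic.RingSolver using (solve-∀)
open import Data.List using (List; []; _∷_; length; replicate; _++_; map)
open import Data.List.Relation.Unary.All using (All; []; _∷_)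
import Data.List.Relation.Unary.All as All
import Data.List.Relation.Unary.All.Properties as Allₚ
open import Data.Fin using (toℕ)
open import Data.Vec using (Vec; toList; tabulate; lookup)
import Data.Vec.Properties as Vecₚ
open import Data.Product using (∃; _,_)
open import Data.Sum using (_⊎_; inj₁; inj₂)
import Data.Sum as Sum
open import Data.Empty using (⊥)
open import Function using (_∘_)
open import Relation.Nullary using (Dec; yes; no; contradiction)
open import Relation.Binary.PropositionalEquality using (refl; sym; trans; cong; cong₂; subst; module ≡-Reasoning)

prime∣*⇒∣⊎∣ : ∀ {p} → Prime p → ∀ a b → + p ∣ₛ a * b → + p ∣ₛ a ⊎ + p ∣ₛ b
prime∣*⇒∣⊎∣ {p} pp a b p∣ab =
  Sum.map ∣ᵤ⇒∣ ∣ᵤ⇒∣ (euclidsLemma ∣ a ∣ ∣ b ∣ pp (subst (p ℕD.∣_) (abs-* a b) (∣⇒∣ᵤ p∣ab)))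

prime∣[1+j]*b⇒∣b : ∀ {p j b} → Prime p → suc j ℕ.< p → + p ∣ₛ + suc j * b → + p ∣ₛ b
prime∣[1+j]*b⇒∣b {j = j} {b} pp 1+j<p p∣[1+j]b with prime∣*⇒∣⊎∣ pp (+ suc j) b p∣[1+j]b
... | inj₁ p∣1+j = contradiction (ℕD.∣⇒≤ (∣⇒∣ᵤ p∣1+j)) (ℕP.<⇒≱ 1+j<p)
... | inj₂ p∣b   = p∣b

prime*u∤u : ∀ {p u} → Prime p → u ≢ 0ℤ → ¬ (+ p * u ∣ₛ u)
prime*u∤u {p} {u} pp u≢0 pu∣u = ¬prime[1] (subst Prime (ℕD.∣1⇒≡1 (∣⇒∣ᵤ p∣1)) pp)
  where
  instance _ = ≢-nonZero u≢0
  p∣1 : + p ∣ₛ 1ℤ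
  p∣1 = *-cancelʳ-∣ u (subst (+ p * u ∣ₛ_) (sym (*-identityˡ u)) pu∣u)

prime≤n⇒∣n! : ∀ {p n} → Prime p → p ℕ.≤ n → p ℕD.∣ n !
prime≤n⇒∣n! {zero}  pp _   = contradiction pp ¬prime[0]
prime≤n⇒∣n! {suc q} _  p≤n = ℕD.∣-trans (ℕD.m∣m*n (q !)) (ℕD.m≤n⇒m!∣n! p≤n)

∣⇒%≡0 : ∀ g c .{{_ : NonZero c}} → c ∣ₛ g → g % c ≡ 0
∣⇒%≡0 g c c∣g with g % c in r≡
... | zero  = refl
... | suc r = contradiction (∣⇒∣ᵤ c∣1+r) (ℕD.>⇒∤ (subst (ℕ._< ∣ c ∣) r≡ (n%d<d g c)))
  where
  remainder : g - g / c * c ≡ + suc r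
  remainder = begin
    g - g / c * c                       ≡⟨ cong (_- g / c * c) (a≡a%n+[a/n]*n g c) ⟩
    (+ (g % c) + g / c * c) - g / c * c ≡⟨ [a+b]-b≡a (+ (g % c)) (g / c * c) ⟩
    + (g % c)                           ≡⟨ cong +_ r≡ ⟩
    + suc r                             ∎
    where
    open ≡-Reasoning
    [a+b]-b≡a : ∀ a b → (a + b) - b ≡ a
    [a+b]-b≡a = solve-∀
  c∣1+r : c ∣ₛ + suc r
  c∣1+r = subst (c ∣ₛ_) remainder (∣m∣n⇒∣m-n c∣g (∣n⇒∣m*n (g / c) ∣-refl))

[g/c]*c≡g : ∀ {c g} .{{_ : NonZero c}} → c ∣ₛ g → g / c * c ≡ g
[g/c]*c≡g {c} {g} c∣g =
  sym (trans (a≡a%n+[a/n]*n g c) (trans (cong (λ r → + r + g / c * c) (∣⇒%≡0 g c c∣g)) (+-identityˡ _)))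

divBy-*-cancel : ∀ {c g} → c ∣ₛ g → divBy g c * c ≡ g
divBy-*-cancel {+ zero}      (divides q g≡q*0) = sym (trans g≡q*0 (*-zeroʳ q))
divBy-*-cancel {+ suc _}     c∣g = [g/c]*c≡g c∣g
divBy-*-cancel { -[1+ _ ]}   c∣g = [g/c]*c≡g c∣g

horner : List ℤ → ℤ → ℤ
horner []       y = 0ℤ
horner (a ∷ as) y = a + y * horner as y

horner-∣ : ∀ {d} xs y → All (d ∣ₛ_) xs → d ∣ₛ horner xs y
horner-∣ []       y []         = divides 0ℤ refl
horner-∣ (x ∷ xs) y (d∣x ∷ d∣xs) = ∣m∣n⇒∣m+n d∣x (∣n⇒∣m*n y (horner-∣ xs y d∣xs))

horner-zeros : ∀ k ys → horner (replicate k 0ℤ ++ ys) 1ℤ ≡ horner ys 1ℤ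
horner-zeros zero    ys = refl
horner-zeros (suc k) ys = trans (+-identityˡ _) (trans (*-identityˡ _) (horner-zeros k ys))

synDiv : ℤ → List ℤ → List ℤ
synDiv r []       = []
synDiv r (d ∷ ds) = horner (d ∷ ds) r ∷ synDiv r ds

length-synDiv : ∀ r cs → length (synDiv r cs) ≡ length cs
length-synDiv r []       = refl
length-synDiv r (d ∷ ds) = cong suc (length-synDiv r ds)

horner-synDiv : ∀ r t c cs → horner (c ∷ cs) t ≡ horner (c ∷ cs) r + (t - r) * horner (synDiv r cs) t
horner-synDiv r t c [] = identity r t c
  where
  identity : ∀ r t c → c + t * 0ℤ ≡ (c + r * 0ℤ) + (t - r) * 0ℤ
  identity = solve-∀
horner-synDiv r t c (d ∷ ds) = begin
  c + t * horner (d ∷ ds) t                       ≡⟨ cong (λ h → c + t * h) (horner-synDiv r t d ds) ⟩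
  c + t * (h + (t - r) * q)                       ≡⟨ identity c t r h q ⟩
  (c + r * h) + (t - r) * (h + t * q)             ∎
  where
  open ≡-Reasoning
  h = horner (d ∷ ds) r
  q = horner (synDiv r ds) t
  identity : ∀ c t r h q → c + t * (h + (t - r) * q) ≡ (c + r * h) + (t - r) * (h + t * q)
  identity = solve-∀

prime∣consecutive⇒prime∣all : ∀ {p} → Prime p → ∀ s cs → length cs ℕ.≤ p →
  (∀ j → j ℕ.< length cs → + p ∣ₛ horner cs (s + + j)) → ∀ y → + p ∣ₛ horner cs y
prime∣consecutive⇒prime∣all {p} pp s cs = go (length cs) s cs refl
  where
  go : ∀ L s cs → length cs ≡ L → length cs ℕ.≤ p →
       (∀ j → j ℕ.< length cs → + p ∣ₛ horner cs (s + + j)) → ∀ y → + p ∣ₛ horner cs y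
  go L       s []       _    _    _      y = divides 0ℤ refl
  go zero    s (c ∷ cs) ()
  go (suc L) s (c ∷ cs) len≡ len≤p p∣f[s+j] y =
    subst (+ p ∣ₛ_) (sym (horner-synDiv s y c cs)) (∣m∣n⇒∣m+n p∣f[s] (∣n⇒∣m*n (y - s) p∣q[y]))
    where
    q = synDiv s cs
    len-q≡ : length q ≡ length cs
    len-q≡ = length-synDiv s cs
    p∣f[s] : + p ∣ₛ horner (c ∷ cs) s
    p∣f[s] = subst (λ t → + p ∣ₛ horner (c ∷ cs) t) (+-identityʳ s) (p∣f[s+j] 0 (ℕ.s≤s ℕ.z≤n))
    -- f(s+1+j) - f(s) = (1+j)·q(s+1+j), and 1+j < p is a unit modulo p.
    p∣q[s+1+j] : ∀ j → j ℕ.< length q → + p ∣ₛ horner q ((s + + 1) + + j)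
    p∣q[s+1+j] j j<len = subst (λ t → + p ∣ₛ horner q t) (sym (+-assoc s (+ 1) (+ j)))
      (prime∣[1+j]*b⇒∣b pp (ℕP.<-≤-trans 1+j<len len≤p)
        (subst (λ d → + p ∣ₛ d * horner q t) ([s+a]-s≡a s (+ suc j))
          (∣m+n∣m⇒∣n (subst (+ p ∣ₛ_) (horner-synDiv s t c cs) (p∣f[s+j] (suc j) 1+j<len)) p∣f[s])))
      where
      t = s + + suc j
      1+j<len : suc j ℕ.< suc (length cs)
      1+j<len = ℕ.s≤s (subst (j ℕ.<_) len-q≡ j<len)
      [s+a]-s≡a : ∀ s a → (s + a) - s ≡ a
      [s+a]-s≡a = solve-∀
    p∣q[y] : + p ∣ₛ horner q y
    p∣q[y] = go L (s + + 1) q (trans len-q≡ (ℕP.suc-injective len≡))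
               (subst (ℕ._≤ p) (sym len-q≡) (ℕP.<⇒≤ len≤p)) p∣q[s+1+j] y

prime∣all⇒prime∣coefficients : ∀ {p} → Prime p → ∀ cs → length cs ℕ.≤ p →
  (∀ y → + p ∣ₛ horner cs y) → All (+ p ∣ₛ_) cs
prime∣all⇒prime∣coefficients pp []       _     _     = []
prime∣all⇒prime∣coefficients {p} pp (c ∷ cs) len≤p p∣f =
  p∣c ∷ prime∣all⇒prime∣coefficients pp cs (ℕP.<⇒≤ len≤p)
          (prime∣consecutive⇒prime∣all pp (+ 1) cs (ℕP.<⇒≤ len≤p) p∣g[1+j])
  where
  p∣c : + p ∣ₛ c
  p∣c = subst (+ p ∣ₛ_) (+-identityʳ c) (p∣f 0ℤ)
  p∣g[1+j] : ∀ j → j ℕ.< length cs → + p ∣ₛ horner cs (+ suc j)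
  p∣g[1+j] j j<len =
    prime∣[1+j]*b⇒∣b pp (ℕP.<-≤-trans (ℕ.s≤s j<len) len≤p) (∣m+n∣m⇒∣n (p∣f (+ suc j)) p∣c)

content-∣ : ∀ {k} (v : Vec ℤ k) → All (content v ∣ₛ_) (toList v)
content-∣ Vec.[]       = []
content-∣ (x Vec.∷ xs) = ∣ᵤ⇒∣ (gcd[i,j]∣i x (content xs))
  ∷ All.map (∣-trans (∣ᵤ⇒∣ (gcd[i,j]∣j x (content xs)))) (content-∣ xs)

content-greatest : ∀ {k d} (v : Vec ℤ k) → All (d ∣ₛ_) (toList v) → d ∣ₛ content v
content-greatest Vec.[] [] = divides 0ℤ refl
content-greatest {d = d} (x Vec.∷ xs) (d∣x ∷ d∣xs) =
  ∣ᵤ⇒∣ (gcd-greatest {x} {content xs} {d} (∣⇒∣ᵤ d∣x) (∣⇒∣ᵤ (content-greatest xs d∣xs)))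

content≢0⇒¬allZero : ∀ {k} (v : Vec ℤ k) → content v ≢ 0ℤ → ¬ All (_≡ 0ℤ) (toList v)
content≢0⇒¬allZero Vec.[]        c≢0 []          = c≢0 refl
content≢0⇒¬allZero (._ Vec.∷ xs) c≢0 (refl ∷ zs) = content≢0⇒¬allZero xs (c≢0 ∘ cong (gcd 0ℤ)) zs

eval-1 : ∀ {n} (F : Form n) y → eval F 1ℤ y ≡ horner (toList F) y
eval-1 {zero}  (a Vec.∷ Vec.[]) y = sym (trans (cong (λ h → a + h) (*-zeroʳ y)) (+-identityʳ a))
eval-1 {suc n} (a Vec.∷ as)     y =
  cong₂ (λ b h → b + y * h) (trans (cong (a *_) (^-zeroˡ (suc n))) (*-identityʳ a)) (eval-1 as y)

fixed⇒∣horner : ∀ {n p} {P : Form n} → FixedPrimeDivisor p P → ∀ y → + p ∣ₛ horner (toList P) y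
fixed⇒∣horner {p = p} {P} (_ , fixed) y = subst (+ p ∣ₛ_) (eval-1 P y) (∣ᵤ⇒∣ (fixed 1ℤ y))

horner-primPart : ∀ {m} (G : Form m) y → horner (toList (primPart G)) y * content G ≡ horner (toList G) y
horner-primPart G y = trans (cong (λ xs → horner xs y * content G) (Vecₚ.toList-map _ G))
                            (horner-divBy (toList G) (content-∣ G))
  where
  horner-divBy : ∀ {c} xs → All (c ∣ₛ_) xs → horner (map (λ x → divBy x c) xs) y * c ≡ horner xs y
  horner-divBy     []       []           = refl
  horner-divBy {c} (x ∷ xs) (c∣x ∷ c∣xs) = begin
    (divBy x c + y * h) * c       ≡⟨ distrib (divBy x c) y h c ⟩
    divBy x c * c + y * (h * c)   ≡⟨ cong₂ (λ a b → a + y * b) (divBy-*-cancel c∣x) (horner-divBy xs c∣xs) ⟩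
    x + y * horner xs y           ∎
    where
    open ≡-Reasoning
    h = horner (map (λ x → divBy x c) xs) y
    distrib : ∀ b y h c → (b + y * h) * c ≡ b * c + y * (h * c)
    distrib = solve-∀

primPart-∣⇒* : ∀ {m} d (G : Form m) → All (d ∣ₛ_) (toList (primPart G)) → All (d * content G ∣ₛ_) (toList G)
primPart-∣⇒* d G d∣P = go (toList G) (content-∣ G) (subst (All (d ∣ₛ_)) (Vecₚ.toList-map _ G) d∣P)
  where
  go : ∀ {c} xs → All (c ∣ₛ_) xs → All (d ∣ₛ_) (map (λ x → divBy x c) xs) → All (d * c ∣ₛ_) xs
  go []       []           []         = []
  go {c} (x ∷ xs) (c∣x ∷ c∣xs) (d∣x/c ∷ d∣xs/c) =
    subst (d * c ∣ₛ_) (divBy-*-cancel c∣x) (*-monoˡ-∣ c d∣x/c) ∷ go xs c∣xs d∣xs/c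

noLargeFixedPrimeDivisor : ∀ {m p} (G : Form m) → content G ≢ 0ℤ → m ℕ.< p → ¬ FixedPrimeDivisor p (primPart G)
noLargeFixedPrimeDivisor {p = p} G c≢0 m<p fixed@(pp , _) =
  prime*u∤u pp c≢0 (content-greatest G (primPart-∣⇒* (+ p) G p∣P))
  where
  p∣P : All (+ p ∣ₛ_) (toList (primPart G))
  p∣P = prime∣all⇒prime∣coefficients pp _
          (subst (ℕ._≤ p) (sym (Vecₚ.length-toList (primPart G))) m<p) (fixed⇒∣horner {P = primPart G} fixed)

noFixedPrimeDivisor-dominant : ∀ {m p} (G : Form m) k u T → toList G ≡ replicate k 0ℤ ++ u ∷ T →
  u ≢ 0ℤ → All (+ p * u ∣ₛ_) T → ¬ FixedPrimeDivisor p (primPart G)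
noFixedPrimeDivisor-dominant {p = p} G k u T G≡ u≢0 pu∣T fixed@(pp , _) =
  prime*u∤u pp u≢0 (∣m+n∣n⇒∣m pu∣G[1] (∣n⇒∣m*n 1ℤ (horner-∣ T 1ℤ pu∣T)))
  where
  c = content G
  u∣G : All (u ∣ₛ_) (toList G)
  u∣G = subst (All (u ∣ₛ_)) (sym G≡)
          (Allₚ.++⁺ (Allₚ.replicate⁺ k (divides 0ℤ refl))
                    (∣-refl ∷ All.map (∣-trans (∣n⇒∣m*n (+ p) ∣-refl)) pu∣T))
  pc∣G[1] : + p * c ∣ₛ horner (toList G) 1ℤ
  pc∣G[1] = subst (+ p * c ∣ₛ_) (horner-primPart G 1ℤ) (*-monoˡ-∣ c (fixed⇒∣horner {P = primPart G} fixed 1ℤ))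
  pu∣G[1] : + p * u ∣ₛ u + 1ℤ * horner T 1ℤ
  pu∣G[1] = ∣-trans (*-monoʳ-∣ (+ p) (content-greatest G u∣G))
              (subst (+ p * c ∣ₛ_) (trans (cong (λ xs → horner xs 1ℤ) G≡) (horner-zeros k (u ∷ T))) pc∣G[1])

content≢0 : ∀ {m} (G : Form m) k u T → toList G ≡ replicate k 0ℤ ++ u ∷ T → u ≢ 0ℤ → content G ≢ 0ℤ
content≢0 G k u T G≡ u≢0 c≡0 =
  u≢0 (0∣⇒≡0 (subst (_∣ₛ u) c≡0 (All.head (Allₚ.++⁻ʳ (replicate k 0ℤ) (subst (All _) G≡ (content-∣ G))))))

leadingZeros : ∀ xs → ¬ All (_≡ 0ℤ) xs →
  ∃ λ k → ∃ λ a → ∃ λ rest → a ≢ 0ℤ × xs ≡ replicate k 0ℤ ++ a ∷ rest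
leadingZeros []       xs≢0 = contradiction [] xs≢0
leadingZeros (x ∷ xs) xs≢0 with x ≟ 0ℤ
... | no x≢0 = 0 , x , xs , x≢0 , refl
... | yes refl with leadingZeros xs (xs≢0 ∘ (refl ∷_))
... | k , a , rest , a≢0 , xs≡ = suc k , a , rest , a≢0 , cong (0ℤ ∷_) xs≡

scaleFrom : ℤ → ℕ → List ℤ → List ℤ
scaleFrom N j []       = []
scaleFrom N j (x ∷ xs) = x * N ^ j ∷ scaleFrom N (suc j) xs

toList-substNY : ∀ {n} (F : Form n) N → toList (substNY F N) ≡ scaleFrom N 0 (toList F)
toList-substNY F N = go F 0
  where
  go : ∀ {k} (v : Vec ℤ k) j → toList (tabulate (λ i → lookup v i * N ^ (j ℕ.+ toℕ i))) ≡ scaleFrom N j (toList v)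
  go Vec.[]       j = refl
  go (x Vec.∷ xs) j = cong₂ _∷_ (cong (λ e → x * N ^ e) (ℕP.+-identityʳ j))
    (trans (cong toList (Vecₚ.tabulate-cong (λ i → cong (λ e → lookup xs i * N ^ e) (ℕP.+-suc j (toℕ i)))))
           (go xs (suc j)))

scaleFrom-zeros : ∀ N j k ys → scaleFrom N j (replicate k 0ℤ ++ ys) ≡ replicate k 0ℤ ++ scaleFrom N (j ℕ.+ k) ys
scaleFrom-zeros N j zero    ys = cong (λ e → scaleFrom N e ys) (sym (ℕP.+-identityʳ j))
scaleFrom-zeros N j (suc k) ys =
  cong (0ℤ ∷_) (trans (scaleFrom-zeros N (suc j) k ys)
                      (cong (λ e → replicate k 0ℤ ++ scaleFrom N e ys) (sym (ℕP.+-suc j k))))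

scaleFrom-∣ : ∀ {d} N j xs → d ∣ₛ N ^ j → All (d ∣ₛ_) (scaleFrom N j xs)
scaleFrom-∣ N j []       d∣N^j = []
scaleFrom-∣ N j (x ∷ xs) d∣N^j = ∣n⇒∣m*n x d∣N^j ∷ scaleFrom-∣ N (suc j) xs (∣n⇒∣m*n N d∣N^j)

noFixedPrimeDivisor-substNY : ∀ {n} (F : Form n) k a rest → toList F ≡ replicate k 0ℤ ++ a ∷ rest → a ≢ 0ℤ →
  ∀ N → N ≢ 0ℤ → + (n ! ℕ.* ∣ a ∣) ∣ N → ∀ p → ¬ FixedPrimeDivisor p (primPart (substNY F N))
noFixedPrimeDivisor-substNY {n} F k a rest F≡ a≢0 N N≢0 N₀∣N p fixed@(pp , _) = byCases (p ℕP.≤? n)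
  where
  G = substNY F N
  u = a * N ^ k
  T = scaleFrom N (suc k) rest
  G≡ : toList G ≡ replicate k 0ℤ ++ u ∷ T
  G≡ = trans (toList-substNY F N) (trans (cong (scaleFrom N 0) F≡) (scaleFrom-zeros N 0 k (a ∷ rest)))
  u≢0 : u ≢ 0ℤ
  u≢0 u≡0 = Sum.[ a≢0 , N≢0 ∘ i^n≡0⇒i≡0 N k ] (i*j≡0⇒i≡0∨j≡0 a u≡0)
  byCases : Dec (p ℕ.≤ n) → ⊥
  byCases (no p≰n)  = noLargeFixedPrimeDivisor G (content≢0 G k u T G≡ u≢0) (ℕP.≰⇒> p≰n) fixed
  byCases (yes p≤n) =
    noFixedPrimeDivisor-dominant G k u T G≡ u≢0 (scaleFrom-∣ N (suc k) rest pu∣N^[1+k]) fixed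
    where
    pa∣N : + p * a ∣ₛ N
    pa∣N = ∣ᵤ⇒∣ (subst (ℕD._∣ ∣ N ∣) (sym (abs-* (+ p) a))
             (ℕD.∣-trans (ℕD.*-monoˡ-∣ ∣ a ∣ (prime≤n⇒∣n! pp p≤n)) N₀∣N))
    pu∣N^[1+k] : + p * u ∣ₛ N ^ suc k
    pu∣N^[1+k] = subst (_∣ₛ N ^ suc k) (*-assoc (+ p) a (N ^ k)) (*-monoˡ-∣ (N ^ k) pa∣N)

lemma4p1 : ∀ (n : ℕ) (F : Form n) → content F ≡ 1ℤ → NoRepeatedFactors F →
    Σ ℕ (λ N₀ → 1 ≤ N₀ × (∀ (N : ℤ) → N ≢ + 0 → (+ N₀) ∣ N →
      ∀ (p : ℕ) → ¬ FixedPrimeDivisor p (primPart (substNY F N))))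
lemma4p1 n F content≡1 _
  with leadingZeros (toList F) (content≢0⇒¬allZero F (subst (_≢ 0ℤ) (sym content≡1) λ ()))
... | k , a , rest , a≢0 , F≡ =
  n ! ℕ.* ∣ a ∣ , ℕP.*-mono-≤ (ℕP.1≤n! n) (ℕP.n≢0⇒n>0 (a≢0 ∘ ∣i∣≡0⇒i≡0)) ,
  noFixedPrimeDivisor-substNY F k a rest F≡ a≢0
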